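{- Let $\mathscr C\le\mathbb F_q^n$ be an intersecting linear code with minimum Hamming distance $d$ and dimension $k$. Then \[ n\ \ge\ \sum_{j=0}^{k-1}\left\lceil \frac{k}{q^j}\right\rceil. \]
   Context: For $x\in\mathbb F_q^n$, the Hamming support is $\sigma(x)=\{i: x_i\neq0\}$. A linear code $\mathscr C\le\mathbb F_q^n$ is intersecting if $\sigma(v)\cap\sigma(w)\neq\emptyset$ for all nonzero $v,w\in\mathscr C$. -}

module Defs where

open import Level using (Level; _⊔_) renaming (suc to lsuc)
open import Algebra.Bundles using (CommutativeRing)
open import Data.Nat using (ℕ; zero; suc; _≤_; _^_)
import Data.Nat as ℕ
open import Data.Nat.DivMod using (_/_)
open import Data.Fin using (Fin)
import Data.Fin as Fin
open import Data.List using (map; upTo)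
open import Data.Nat.ListAction using (sum)
open import Data.Product using (Σ; ∃; _×_; _,_)
open import Data.Bool using (if_then_else_)
open import Relation.Nullary using (¬_; does)
open import Relation.Binary.Definitions using (Decidable)
open import Relation.Binary.PropositionalEquality using (_≡_)

record FiniteField (c ℓ : Level) (q : ℕ) : Set (lsuc (c ⊔ ℓ)) where
  field
    commRing : CommutativeRing c ℓ
  open CommutativeRing commRing public hiding (ring)
  field
    _≟_      : Decidable _≈_
    0≉1      : ¬ (0# ≈ 1#)
    inverse  : ∀ x → ¬ (x ≈ 0#) → ∃ λ y → (x * y) ≈ 1#
    enum     : Fin q → Carrier
    enum-inj : ∀ i j → enum i ≈ enum j → i ≡ j
    enum-sur : ∀ x → ∃ λ i → enum i ≈ x

module _ {c ℓ : Level} {q : ℕ} (F : FiniteField c ℓ q) where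
  open FiniteField F

  Vec : ℕ → Set c
  Vec n = Fin n → Carrier

  _≈ᵥ_ : ∀ {n} → Vec n → Vec n → Set ℓ
  u ≈ᵥ v = ∀ i → u i ≈ v i

  0ᵥ : ∀ {n} → Vec n
  0ᵥ _ = 0#

  _+ᵥ_ : ∀ {n} → Vec n → Vec n → Vec n
  (u +ᵥ v) i = u i + v i

  _-ᵥ_ : ∀ {n} → Vec n → Vec n → Vec n
  (u -ᵥ v) i = u i - v i

  _•_ : ∀ {n} → Carrier → Vec n → Vec n
  (a • v) i = a * v i

  record IsLinearCode {n : ℕ} (C : Vec n → Set ℓ) : Set (c ⊔ ℓ) where
    field
      resp  : ∀ u v → u ≈ᵥ v → C u → C v
      has0  : C 0ᵥ
      +-cl  : ∀ u v → C u → C v → C (u +ᵥ v)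
      •-cl  : ∀ a v → C v → C (a • v)

  lincomb : ∀ {n k} → (Fin k → Carrier) → (Fin k → Vec n) → Vec n
  lincomb {k = zero}  a b = 0ᵥ
  lincomb {k = suc k} a b = (a Fin.zero • b Fin.zero) +ᵥ lincomb (λ j → a (Fin.suc j)) (λ j → b (Fin.suc j))

  IsBasis : ∀ {n k} → (Vec n → Set ℓ) → (Fin k → Vec n) → Set (c ⊔ ℓ)
  IsBasis C b =
    (∀ j → C (b j)) ×
    (∀ a → lincomb a b ≈ᵥ 0ᵥ → ∀ j → a j ≈ 0#) ×
    (∀ v → C v → ∃ λ a → lincomb a b ≈ᵥ v)

  HasDimension : ∀ {n} → (Vec n → Set ℓ) → ℕ → Set (c ⊔ ℓ)
  HasDimension {n} C k = Σ (Fin k → Vec n) λ b → IsBasis C b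

  Nonzero : ∀ {n} → Vec n → Set ℓ
  Nonzero v = ¬ (v ≈ᵥ 0ᵥ)

  Intersecting : ∀ {n} → (Vec n → Set ℓ) → Set (c ⊔ ℓ)
  Intersecting {n} C = ∀ v w → C v → C w → Nonzero v → Nonzero w →
    ∃ λ (i : Fin n) → ¬ (v i ≈ 0#) × ¬ (w i ≈ 0#)

  weight : ∀ {n} → Vec n → ℕ
  weight {zero}  v = 0
  weight {suc n} v =
    (if does (v Fin.zero ≟ 0#) then 0 else 1) ℕ.+ weight (λ i → v (Fin.suc i))

  hammingDist : ∀ {n} → Vec n → Vec n → ℕ
  hammingDist u v = weight (u -ᵥ v)

  MinDistance : ∀ {n} → (Vec n → Set ℓ) → ℕ → Set (c ⊔ ℓ)
  MinDistance C d =
    (∃ λ u → ∃ λ v → C u × C v × ¬ (u ≈ᵥ v) × hammingDist u v ≡ d) ×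
    (∀ u v → C u → C v → ¬ (u ≈ᵥ v) → d ≤ hammingDist u v)

-- ⌈ a / m ⌉ (only used with m = q^j ≥ 1)
⌈_/_⌉ : ℕ → ℕ → ℕ
⌈ a / zero ⌉  = 0
⌈ a / suc m ⌉ = (a ℕ.+ m) / suc m

Σ< : ℕ → (ℕ → ℕ) → ℕ
Σ< k f = sum (map f (upTo k))

{-# OPTIONS --safe #-}
module Submission where

-- Every nonzero codeword v of an intersecting code has weight at least k: no nonzero codeword
-- vanishes on σ(v), so the code restricted to the coordinates σ(v) still has dimension k.
-- The claim is then Griesmer's bound n ≥ Σ_{j<k} ⌈d/q^j⌉ with d replaced by k.
--
-- Griesmer's bound is proved for weights counted on a set S of coordinates, by induction on k.
-- Let c = φ a₀ have minimal weight d on S and let a₀ j ≠ 0. The coefficient vectors a with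
-- a j = 0 give a code of dimension k - 1 whose weights on S ∖ σ(c) are at least ⌈d/q⌉: for
-- x = φ a, averaging over the line x + t c (t ∈ F_q) gives
--   q d ≤ Σ_t wt_S(x + t c) ≤ q wt_{S∖σ(c)}(x) + (q - 1) d.

open import Defs hiding (_≈ᵥ_; _+ᵥ_; _•_)
import Defs as D
open import Level using (Level; _⊔_)
open import Algebra.Bundles using (CommutativeRing)
open import Data.Bool using (Bool; true; false; not; _∧_)
open import Data.Fin as Fin using (Fin; punchIn)
open import Data.Fin.Properties using (¬∀⟶∃¬; nonZeroIndex)
open import Data.List using (upTo)
open import Data.List.Properties using (map-cong; map-applyUpTo)
import Data.Nat.ListAction as List
open import Data.Nat using (ℕ; zero; suc; _+_; _*_; _^_; _≤_; _<_; z≤n; s≤s; s≤s⁻¹; _≤?_; NonZero)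
import Data.Nat.Properties as ℕₚ
open import Data.Nat.DivMod using (_%_; m≡m%n+[m/n]*n; m%n<n; m<n*o⇒m/o<n; n/n≡1; n/1≡n)
open import Data.Product using (∃; _×_; _,_; proj₁; proj₂)
open import Data.Vec.Functional using (Vector; insertAt; removeAt; zipWith)
open import Data.Vec.Functional.Properties using (insertAt-lookup; insertAt-punchIn)
open import Data.Vec.Functional.Relation.Binary.Pointwise using (Pointwise)
open import Function using (_∘_; id)
open import Relation.Binary.Core using (REL)
import Relation.Binary.Reasoning.Setoid as SetoidReasoning
open import Relation.Nullary using (¬_; yes; no; does; contradiction)
open import Relation.Unary using (Pred; Decidable)
open import Relation.Binary.PropositionalEquality using (_≡_; _≗_; refl; sym; trans; cong; cong₂; subst; module ≡-Reasoning)
open import Algebra.Properties.Semiring.Sum ℕₚ.+-*-semiring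
  using (sum; sum-syntax; sum-cong-≗; sum-remove; ∑-comm; ∑-distrib-+; *-distribˡ-sum)

sum-mono-≤ : ∀ {n} {f g : Fin n → ℕ} → (∀ i → f i ≤ g i) → sum f ≤ sum g
sum-mono-≤ {zero}  _   = z≤n
sum-mono-≤ {suc n} f≤g = ℕₚ.+-mono-≤ (f≤g Fin.zero) (sum-mono-≤ (f≤g ∘ Fin.suc))

sum-const : ∀ n c → ∑[ _ < n ] c ≡ n * c
sum-const zero    c = refl
sum-const (suc n) c = cong (c +_) (sum-const n c)

m≤sum : ∀ {n} (f : Fin n → ℕ) i → f i ≤ sum f
m≤sum {suc n} f i = subst (f i ≤_) (sym (sum-remove {i = i} f)) (ℕₚ.m≤m+n (f i) _)

sum<n : ∀ {n} (f : Fin n → ℕ) i → (∀ t → f t ≤ 1) → f i ≡ 0 → sum f < n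
sum<n {suc n} f i f≤1 fi≡0 = s≤s (begin
  sum f                    ≡⟨ sum-remove {i = i} f ⟩
  f i + sum (removeAt f i) ≡⟨ cong (_+ sum (removeAt f i)) fi≡0 ⟩
  sum (removeAt f i)       ≤⟨ sum-mono-≤ (f≤1 ∘ punchIn i) ⟩
  ∑[ _ < n ] 1             ≡⟨ sum-const n 1 ⟩
  n * 1                    ≡⟨ ℕₚ.*-identityʳ n ⟩
  n                        ∎)
  where open ℕₚ.≤-Reasoning

Σ<-suc : ∀ k f → Σ< (suc k) f ≡ f 0 + Σ< k (f ∘ suc)
Σ<-suc k f = cong (f 0 +_) (cong List.sum
  (trans (map-applyUpTo suc f k) (sym (map-applyUpTo id (f ∘ suc) k))))

Σ<-cong : ∀ k {f g : ℕ → ℕ} → (∀ j → f j ≡ g j) → Σ< k f ≡ Σ< k g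
Σ<-cong k f≗g = cong List.sum (map-cong f≗g (upTo k))

Σ<-mono-≤ : ∀ k {f g : ℕ → ℕ} → (∀ j → f j ≤ g j) → Σ< k f ≤ Σ< k g
Σ<-mono-≤ zero    _ = z≤n
Σ<-mono-≤ (suc k) {f} {g} f≤g = begin
  Σ< (suc k) f          ≡⟨ Σ<-suc k f ⟩
  f 0 + Σ< k (f ∘ suc)  ≤⟨ ℕₚ.+-mono-≤ (f≤g 0) (Σ<-mono-≤ k (f≤g ∘ suc)) ⟩
  g 0 + Σ< k (g ∘ suc)  ≡⟨ Σ<-suc k g ⟨
  Σ< (suc k) g          ∎
  where open ℕₚ.≤-Reasoning

Σ<-1 : ∀ k → Σ< k (λ _ → 1) ≡ k
Σ<-1 zero    = refl
Σ<-1 (suc k) = trans (Σ<-suc k (λ _ → 1)) (cong suc (Σ<-1 k))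

m≤⌈m/n⌉*n : ∀ m n .{{_ : NonZero n}} → m ≤ ⌈ m / n ⌉ * n
m≤⌈m/n⌉*n m (suc n) = ℕₚ.+-cancelʳ-≤ n m (⌈ m / suc n ⌉ * suc n) (begin
  m + n                                   ≡⟨ m≡m%n+[m/n]*n (m + n) (suc n) ⟩
  (m + n) % suc n + ⌈ m / suc n ⌉ * suc n ≤⟨ ℕₚ.+-monoˡ-≤ _ (s≤s⁻¹ (m%n<n (m + n) (suc n))) ⟩
  n + ⌈ m / suc n ⌉ * suc n               ≡⟨ ℕₚ.+-comm n _ ⟩
  ⌈ m / suc n ⌉ * suc n + n               ∎)
  where open ℕₚ.≤-Reasoning

⌈m/n⌉≤o : ∀ {m n o} .{{_ : NonZero n}} → m ≤ o * n → ⌈ m / n ⌉ ≤ o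
⌈m/n⌉≤o {m} {suc n} {o} m≤o*n = s≤s⁻¹ (m<n*o⇒m/o<n (begin-strict
  m + n             ≡⟨ ℕₚ.+-comm m n ⟩
  n + m             <⟨ s≤s (ℕₚ.+-monoʳ-≤ n m≤o*n) ⟩
  suc n + o * suc n ∎))
  where open ℕₚ.≤-Reasoning

⌈⌉-monoˡ-≤ : ∀ {m m′} n .{{_ : NonZero n}} → m ≤ m′ → ⌈ m / n ⌉ ≤ ⌈ m′ / n ⌉
⌈⌉-monoˡ-≤ {m′ = m′} n m≤m′ = ⌈m/n⌉≤o (ℕₚ.≤-trans m≤m′ (m≤⌈m/n⌉*n m′ n))

⌈1/n⌉≡1 : ∀ n .{{_ : NonZero n}} → ⌈ 1 / n ⌉ ≡ 1
⌈1/n⌉≡1 (suc n) = n/n≡1 (suc n)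

⌈n/1⌉≡n : ∀ n → ⌈ n / 1 ⌉ ≡ n
⌈n/1⌉≡n n = trans (n/1≡n (n + 0)) (ℕₚ.+-identityʳ n)

⌈m/[n*o]⌉≤⌈⌈m/n⌉/o⌉ : ∀ m n .{{_ : NonZero n}} o .{{_ : NonZero o}} →
                      ⌈ m / (n * o) ⌉ ≤ ⌈ ⌈ m / n ⌉ / o ⌉
⌈m/[n*o]⌉≤⌈⌈m/n⌉/o⌉ m n o = ⌈m/n⌉≤o {{ℕₚ.m*n≢0 n o}} (begin
  m             ≤⟨ m≤⌈m/n⌉*n m n ⟩
  ⌈ m / n ⌉ * n ≤⟨ ℕₚ.*-monoˡ-≤ n (m≤⌈m/n⌉*n ⌈ m / n ⌉ o) ⟩
  t * o * n     ≡⟨ ℕₚ.*-assoc t o n ⟩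
  t * (o * n)   ≡⟨ cong (t *_) (ℕₚ.*-comm o n) ⟩
  t * (n * o)   ∎)
  where
  t = ⌈ ⌈ m / n ⌉ / o ⌉
  open ℕₚ.≤-Reasoning

griesmer : ℕ → ℕ → ℕ → ℕ
griesmer q k d = Σ< k (λ j → ⌈ d / q ^ j ⌉)

module _ (q : ℕ) .{{_ : NonZero q}} where

  griesmer-monoʳ-≤ : ∀ k {d d′} → d ≤ d′ → griesmer q k d ≤ griesmer q k d′
  griesmer-monoʳ-≤ k d≤d′ = Σ<-mono-≤ k (λ j → ⌈⌉-monoˡ-≤ (q ^ j) {{ℕₚ.m^n≢0 q j}} d≤d′)

  griesmer-1 : ∀ k → griesmer q k 1 ≡ k
  griesmer-1 k = trans (Σ<-cong k (λ j → ⌈1/n⌉≡1 (q ^ j) {{ℕₚ.m^n≢0 q j}})) (Σ<-1 k)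

  griesmer-suc : ∀ k d → griesmer q (suc k) d ≤ d + griesmer q k ⌈ d / q ⌉
  griesmer-suc k d = begin
    griesmer q (suc k) d                         ≡⟨ Σ<-suc k _ ⟩
    ⌈ d / 1 ⌉ + Σ< k (λ j → ⌈ d / q * q ^ j ⌉)  ≤⟨ ℕₚ.+-mono-≤ (ℕₚ.≤-reflexive (⌈n/1⌉≡n d))
                                                     (Σ<-mono-≤ k (λ j → ⌈m/[n*o]⌉≤⌈⌈m/n⌉/o⌉ d q (q ^ j) {{ℕₚ.m^n≢0 q j}})) ⟩
    d + griesmer q k ⌈ d / q ⌉                   ∎
    where open ℕₚ.≤-Reasoning

module _ {p r} {P : Pred ℕ p} {Q : Pred ℕ r} (N : ℕ) (Q? : Decidable Q)
         (Q-antitone : ∀ {d} → Q (suc d) → Q d) (P-bounded : ∀ {d} → P d → d ≤ N)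
         (P-step : ∀ {d} → P d → ¬ Q d → P (suc d)) where

  bounded-upward-induction : ∀ {d} → P d → Q d
  bounded-upward-induction {d} = go (suc N) (ℕₚ.m≤n+m (suc N) d)
    where
    go : ∀ fuel {d} → N < d + fuel → P d → Q d
    go zero       {d} N<d+0 Pd = contradiction (P-bounded Pd)
                                   (ℕₚ.<⇒≱ (subst (N <_) (ℕₚ.+-identityʳ d) N<d+0))
    go (suc fuel) {d} N<d+1+f Pd with Q? d
    ... | yes Qd = Qd
    ... | no ¬Qd = Q-antitone (go fuel (subst (N <_) (ℕₚ.+-suc d fuel) N<d+1+f) (P-step Pd ¬Qd))

[_] : Bool → ℕ
[ true  ] = 1
[ false ] = 0

∣_∣ : ∀ {n} → (Fin n → Bool) → ℕ
∣ S ∣ = ∑[ i < _ ] [ S i ]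

_∩_ : ∀ {n} → (Fin n → Bool) → (Fin n → Bool) → Fin n → Bool
(S ∩ T) i = S i ∧ T i

_∖_ : ∀ {n} → (Fin n → Bool) → (Fin n → Bool) → Fin n → Bool
(S ∖ T) i = S i ∧ not (T i)

[b]≤1 : ∀ b → [ b ] ≤ 1
[b]≤1 true  = ℕₚ.≤-refl
[b]≤1 false = z≤n

∣S∩T∣≤∣S∣ : ∀ {n} (S T : Fin n → Bool) → ∣ S ∩ T ∣ ≤ ∣ S ∣
∣S∩T∣≤∣S∣ S T = sum-mono-≤ (λ i → [s∧t]≤[s] (S i) (T i))
  where
  [s∧t]≤[s] : ∀ s t → [ s ∧ t ] ≤ [ s ]
  [s∧t]≤[s] true  t = [b]≤1 t
  [s∧t]≤[s] false t = z≤n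

∣S∩T∣+∣S∖T∣≡∣S∣ : ∀ {n} (S T : Fin n → Bool) → ∣ S ∩ T ∣ + ∣ S ∖ T ∣ ≡ ∣ S ∣
∣S∩T∣+∣S∖T∣≡∣S∣ S T = trans (sym (∑-distrib-+ (λ i → [ S i ∧ T i ]) (λ i → [ S i ∧ not (T i) ])))
                             (sum-cong-≗ (λ i → split (S i) (T i)))
  where
  split : ∀ s t → [ s ∧ t ] + [ s ∧ not t ] ≡ [ s ]
  split true  true  = refl
  split true  false = refl
  split false t     = refl

∣full∣≡n : ∀ n → ∣ (λ (_ : Fin n) → true) ∣ ≡ n
∣full∣≡n n = trans (sum-const n 1) (ℕₚ.*-identityʳ n)

module _ {a b r} {A : Set a} {B : Set b} {R : REL A B r} where

  insertAt⁺ : ∀ {n} {u : Vector A n} {v : Vector B n} {x y} j →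
              Pointwise R u v → R x y → Pointwise R (insertAt u j x) (insertAt v j y)
  insertAt⁺ Fin.zero uRv xRy Fin.zero    = xRy
  insertAt⁺ Fin.zero uRv xRy (Fin.suc l) = uRv l
  insertAt⁺ {suc n} (Fin.suc j) uRv xRy Fin.zero    = uRv Fin.zero
  insertAt⁺ {suc n} (Fin.suc j) uRv xRy (Fin.suc l) = insertAt⁺ j (uRv ∘ Fin.suc) xRy l

insertAt-zipWith : ∀ {a b c} {A : Set a} {B : Set b} {C : Set c} (f : A → B → C) {n}
                   (u : Vector A n) (v : Vector B n) j x y →
                   insertAt (zipWith f u v) j (f x y) ≗ zipWith f (insertAt u j x) (insertAt v j y)
insertAt-zipWith f u v Fin.zero x y Fin.zero    = refl
insertAt-zipWith f u v Fin.zero x y (Fin.suc l) = refl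
insertAt-zipWith f {suc n} u v (Fin.suc j) x y Fin.zero    = refl
insertAt-zipWith f {suc n} u v (Fin.suc j) x y (Fin.suc l) =
  insertAt-zipWith f (u ∘ Fin.suc) (v ∘ Fin.suc) j x y l

module _ {a ℓ : Level} {q : ℕ} (F : FiniteField a ℓ q) where

  open FiniteField F
    hiding (zero)
    renaming (_+_ to _+ᶠ_; _*_ to _*ᶠ_; refl to ≈-refl; sym to ≈-sym; trans to ≈-trans; reflexive to ≈-reflexive)
  open import Algebra.Properties.Ring (CommutativeRing.ring commRing) using (-‿distribˡ-*)
  open import Algebra.Properties.CommutativeSemigroup (CommutativeRing.+-commutativeSemigroup commRing)
    using (interchange)
  module ≈-Reasoning = SetoidReasoning setoid

  -- Defs' vector operations take the field as an explicit argument and have no fixity.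
  infix  4 _≈ᵥ_
  infixl 6 _+ᵥ_
  infixl 7 _•_

  _≈ᵥ_ : ∀ {n} → Vec F n → Vec F n → Set ℓ
  _≈ᵥ_ = D._≈ᵥ_ F

  _+ᵥ_ : ∀ {n} → Vec F n → Vec F n → Vec F n
  _+ᵥ_ = D._+ᵥ_ F

  _•_ : ∀ {n} → Carrier → Vec F n → Vec F n
  _•_ = D._•_ F

  instance
    q≢0 : NonZero q
    q≢0 = nonZeroIndex (proj₁ (enum-sur 0#))

  nonzero? : Carrier → Bool
  nonzero? x = not (does (x ≟ 0#))

  supp : ∀ {n} → Vec F n → Fin n → Bool
  supp v i = nonzero? (v i)

  weightOn : ∀ {n} → (Fin n → Bool) → Vec F n → ℕ
  weightOn S v = ∣ S ∩ supp v ∣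

  nonzero?-≈0 : ∀ {x} → x ≈ 0# → nonzero? x ≡ false
  nonzero?-≈0 {x} x≈0 with x ≟ 0#
  ... | yes _   = refl
  ... | no x≉0 = contradiction x≈0 x≉0

  nonzero?-≉0 : ∀ {x} → ¬ x ≈ 0# → nonzero? x ≡ true
  nonzero?-≉0 {x} x≉0 with x ≟ 0#
  ... | yes x≈0 = contradiction x≈0 x≉0
  ... | no _    = refl

  nonzero?-cong : ∀ {x y} → x ≈ y → nonzero? x ≡ nonzero? y
  nonzero?-cong {x} {y} x≈y with y ≟ 0#
  ... | yes y≈0 = nonzero?-≈0 (≈-trans x≈y y≈0)
  ... | no y≉0  = nonzero?-≉0 (y≉0 ∘ ≈-trans (≈-sym x≈y))

  weightOn-cong : ∀ {n} (S : Fin n → Bool) {u v : Vec F n} → u ≈ᵥ v → weightOn S u ≡ weightOn S v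
  weightOn-cong S u≈v = sum-cong-≗ (λ i → cong (λ b → [ S i ∧ b ]) (nonzero?-cong (u≈v i)))

  x+y≈0∧x≈0⇒y≈0 : ∀ {x y} → x +ᶠ y ≈ 0# → x ≈ 0# → y ≈ 0#
  x+y≈0∧x≈0⇒y≈0 {x} {y} x+y≈0 x≈0 = begin
    y        ≈⟨ +-identityˡ y ⟨
    0# +ᶠ y  ≈⟨ +-congʳ x≈0 ⟨
    x +ᶠ y   ≈⟨ x+y≈0 ⟩
    0#       ∎
    where open ≈-Reasoning

  x+y≈0∧y≈0⇒x≈0 : ∀ {x y} → x +ᶠ y ≈ 0# → y ≈ 0# → x ≈ 0#
  x+y≈0∧y≈0⇒x≈0 {x} {y} x+y≈0 = x+y≈0∧x≈0⇒y≈0 (≈-trans (+-comm y x) x+y≈0)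

  x*y≈0∧y≉0⇒x≈0 : ∀ {x y} → x *ᶠ y ≈ 0# → ¬ y ≈ 0# → x ≈ 0#
  x*y≈0∧y≉0⇒x≈0 {x} {y} xy≈0 y≉0 = begin
    x                ≈⟨ *-identityʳ x ⟨
    x *ᶠ 1#          ≈⟨ *-congˡ yy⁻¹≈1 ⟨
    x *ᶠ (y *ᶠ y⁻¹)  ≈⟨ *-assoc x y y⁻¹ ⟨
    (x *ᶠ y) *ᶠ y⁻¹  ≈⟨ *-congʳ xy≈0 ⟩
    0# *ᶠ y⁻¹        ≈⟨ zeroˡ y⁻¹ ⟩
    0#               ∎
    where
    open ≈-Reasoning
    y⁻¹ : Carrier
    y⁻¹ = proj₁ (inverse y y≉0)
    yy⁻¹≈1 : y *ᶠ y⁻¹ ≈ 1#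
    yy⁻¹≈1 = proj₂ (inverse y y≉0)

  line-meets-0 : ∀ x {c} → ¬ c ≈ 0# → ∃ λ t → x +ᶠ enum t *ᶠ c ≈ 0#
  line-meets-0 x {c} c≉0 = t , (begin
    x +ᶠ enum t *ᶠ c          ≈⟨ +-congˡ (*-congʳ enum-t≈-xc⁻¹) ⟩
    x +ᶠ - (x *ᶠ c⁻¹) *ᶠ c    ≈⟨ +-congˡ (-‿distribˡ-* (x *ᶠ c⁻¹) c) ⟨
    x +ᶠ - (x *ᶠ c⁻¹ *ᶠ c)    ≈⟨ +-congˡ (-‿cong x*c⁻¹*c≈x) ⟩
    x +ᶠ - x                  ≈⟨ -‿inverseʳ x ⟩
    0#                        ∎)
    where
    open ≈-Reasoning
    c⁻¹ : Carrier
    c⁻¹ = proj₁ (inverse c c≉0)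
    t : Fin q
    t = proj₁ (enum-sur (- (x *ᶠ c⁻¹)))
    enum-t≈-xc⁻¹ : enum t ≈ - (x *ᶠ c⁻¹)
    enum-t≈-xc⁻¹ = proj₂ (enum-sur (- (x *ᶠ c⁻¹)))
    x*c⁻¹*c≈x : x *ᶠ c⁻¹ *ᶠ c ≈ x
    x*c⁻¹*c≈x = begin
      x *ᶠ c⁻¹ *ᶠ c    ≈⟨ *-assoc x c⁻¹ c ⟩
      x *ᶠ (c⁻¹ *ᶠ c)  ≈⟨ *-congˡ (≈-trans (*-comm c⁻¹ c) (proj₂ (inverse c c≉0))) ⟩
      x *ᶠ 1#          ≈⟨ *-identityʳ x ⟩
      x                ∎

  ∑-line-≈0 : ∀ x {c} → c ≈ 0# → ∑[ t < q ] [ nonzero? (x +ᶠ enum t *ᶠ c) ] ≡ q * [ nonzero? x ]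
  ∑-line-≈0 x {c} c≈0 = trans (sum-cong-≗ (λ t → cong [_] (nonzero?-cong (x+t*c≈x t)))) (sum-const q _)
    where
    x+t*c≈x : ∀ t → x +ᶠ enum t *ᶠ c ≈ x
    x+t*c≈x t = ≈-trans (+-congˡ (≈-trans (*-congˡ c≈0) (zeroʳ (enum t)))) (+-identityʳ x)

  ∑-line-≉0 : ∀ x {c} → ¬ c ≈ 0# → ∑[ t < q ] [ nonzero? (x +ᶠ enum t *ᶠ c) ] < q
  ∑-line-≉0 x c≉0 with line-meets-0 x c≉0
  ... | t , x+t*c≈0 = sum<n _ t (λ _ → [b]≤1 _) (cong [_] (nonzero?-≈0 x+t*c≈0))

  line-count : ∀ s x c →
    ∑[ t < q ] [ s ∧ nonzero? (x +ᶠ enum t *ᶠ c) ] + [ s ∧ nonzero? c ] ≤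
    q * ([ (s ∧ not (nonzero? c)) ∧ nonzero? x ] + [ s ∧ nonzero? c ])
  line-count false x c = ℕₚ.≤-reflexive (trans (ℕₚ.+-identityʳ _) (sum-const q 0))
  line-count true  x c with c ≟ 0#
  ... | yes c≈0 = ℕₚ.≤-reflexive (begin
    ∑[ t < q ] [ nonzero? (x +ᶠ enum t *ᶠ c) ] + 0 ≡⟨ ℕₚ.+-identityʳ _ ⟩
    ∑[ t < q ] [ nonzero? (x +ᶠ enum t *ᶠ c) ]     ≡⟨ ∑-line-≈0 x c≈0 ⟩
    q * [ nonzero? x ]                              ≡⟨ cong (q *_) (ℕₚ.+-identityʳ _) ⟨
    q * ([ nonzero? x ] + 0)                        ∎)
    where open ≡-Reasoning
  ... | no c≉0 = begin
    ∑[ t < q ] [ nonzero? (x +ᶠ enum t *ᶠ c) ] + 1 ≡⟨ ℕₚ.+-comm _ 1 ⟩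
    suc (∑[ t < q ] [ nonzero? (x +ᶠ enum t *ᶠ c) ]) ≤⟨ ∑-line-≉0 x c≉0 ⟩
    q                                                ≡⟨ ℕₚ.*-identityʳ q ⟨
    q * 1                                            ∎
    where open ℕₚ.≤-Reasoning

  averaging : ∀ {n} (S : Fin n → Bool) (x c : Vec F n) →
    ∑[ t < q ] weightOn S (x +ᵥ enum t • c) + weightOn S c ≤
    q * (weightOn (S ∖ supp c) x + weightOn S c)
  averaging {n} S x c = begin
    ∑[ t < q ] ∑[ i < n ] g t i + ∑[ i < n ] h i    ≡⟨ cong (_+ ∑[ i < n ] h i) (∑-comm g) ⟩
    ∑[ i < n ] ∑[ t < q ] g t i + ∑[ i < n ] h i    ≡⟨ ∑-distrib-+ (λ i → ∑[ t < q ] g t i) h ⟨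
    ∑[ i < n ] (∑[ t < q ] g t i + h i)             ≤⟨ sum-mono-≤ (λ i → line-count (S i) (x i) (c i)) ⟩
    ∑[ i < n ] (q * (m i + h i))                    ≡⟨ *-distribˡ-sum q (λ i → m i + h i) ⟨
    q * ∑[ i < n ] (m i + h i)                      ≡⟨ cong (q *_) (∑-distrib-+ m h) ⟩
    q * (weightOn (S ∖ supp c) x + weightOn S c)    ∎
    where
    open ℕₚ.≤-Reasoning
    g : Fin q → Fin n → ℕ
    g t i = [ S i ∧ nonzero? (x i +ᶠ enum t *ᶠ c i) ]
    h m : Fin n → ℕ
    h i = [ S i ∧ nonzero? (c i) ]
    m i = [ (S i ∧ not (nonzero? (c i))) ∧ nonzero? (x i) ]

  record IsLinear {k n} (φ : Vec F k → Vec F n) : Set (a ⊔ ℓ) where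
    field
      ≈ᵥ-cong : ∀ {u v} → u ≈ᵥ v → φ u ≈ᵥ φ v
      +ᵥ-homo : ∀ u v → φ (u +ᵥ v) ≈ᵥ φ u +ᵥ φ v
      •-homo  : ∀ α v → φ (α • v) ≈ᵥ α • φ v

    +•-homo : ∀ u α v → φ (u +ᵥ α • v) ≈ᵥ φ u +ᵥ α • φ v
    +•-homo u α v i = ≈-trans (+ᵥ-homo u (α • v) i) (+-congˡ (•-homo α v i))

  ∘-isLinear : ∀ {k m n} {φ : Vec F m → Vec F n} {ψ : Vec F k → Vec F m} →
               IsLinear φ → IsLinear ψ → IsLinear (φ ∘ ψ)
  ∘-isLinear {ψ = ψ} φ-lin ψ-lin = record
    { ≈ᵥ-cong = φ.≈ᵥ-cong ∘ ψ.≈ᵥ-cong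
    ; +ᵥ-homo = λ u v i → ≈-trans (φ.≈ᵥ-cong (ψ.+ᵥ-homo u v) i) (φ.+ᵥ-homo (ψ u) (ψ v) i)
    ; •-homo  = λ α v i → ≈-trans (φ.≈ᵥ-cong (ψ.•-homo α v) i) (φ.•-homo α (ψ v) i)
    }
    where
    module φ = IsLinear φ-lin
    module ψ = IsLinear ψ-lin

  insertAt-isLinear : ∀ {k} (j : Fin (suc k)) → IsLinear (λ (a : Vec F k) → insertAt a j 0#)
  insertAt-isLinear j = record
    { ≈ᵥ-cong = λ u≈v → insertAt⁺ {R = _≈_} j u≈v ≈-refl
    ; +ᵥ-homo = λ u v l → ≈-trans (insertAt⁺ {R = _≈_} j (λ _ → ≈-refl) (≈-sym (+-identityʳ 0#)) l)
                                  (≈-reflexive (insertAt-zipWith _+ᶠ_ u v j 0# 0# l))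
    ; •-homo  = λ α v → insertAt⁺ {R = λ x y → x ≈ α *ᶠ y} j (λ _ → ≈-refl) (≈-sym (zeroʳ α))
    }

  lincomb-isLinear : ∀ {k n} (b : Fin k → Vec F n) → IsLinear (λ a → lincomb F a b)
  lincomb-isLinear b = record { ≈ᵥ-cong = ≈ᵥ-cong b ; +ᵥ-homo = +ᵥ-homo b ; •-homo = •-homo b }
    where
    ≈ᵥ-cong : ∀ {k n} (b : Fin k → Vec F n) {u v} → u ≈ᵥ v → lincomb F u b ≈ᵥ lincomb F v b
    ≈ᵥ-cong {zero}  b u≈v i = ≈-refl
    ≈ᵥ-cong {suc k} b u≈v i = +-cong (*-congʳ (u≈v Fin.zero)) (≈ᵥ-cong (b ∘ Fin.suc) (u≈v ∘ Fin.suc) i)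

    +ᵥ-homo : ∀ {k n} (b : Fin k → Vec F n) u v → lincomb F (u +ᵥ v) b ≈ᵥ lincomb F u b +ᵥ lincomb F v b
    +ᵥ-homo {zero}  b u v i = ≈-sym (+-identityʳ 0#)
    +ᵥ-homo {suc k} b u v i = ≈-trans
      (+-cong (distribʳ (b Fin.zero i) (u Fin.zero) (v Fin.zero))
              (+ᵥ-homo (b ∘ Fin.suc) (u ∘ Fin.suc) (v ∘ Fin.suc) i))
      (interchange _ _ _ _)

    •-homo : ∀ {k n} (b : Fin k → Vec F n) α v → lincomb F (α • v) b ≈ᵥ α • lincomb F v b
    •-homo {zero}  b α v i = ≈-sym (zeroʳ α)
    •-homo {suc k} b α v i = ≈-trans
      (+-cong (*-assoc α (v Fin.zero) (b Fin.zero i)) (•-homo (b ∘ Fin.suc) α (v ∘ Fin.suc) i))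
      (≈-sym (distribˡ α _ _))

  1≤weightOn-supp : ∀ {n} {v w : Vec F n} i → ¬ v i ≈ 0# → ¬ w i ≈ 0# → 1 ≤ weightOn (supp v) w
  1≤weightOn-supp {v = v} {w} i vi≉0 wi≉0 = ℕₚ.≤-trans (ℕₚ.≤-reflexive 1≡[σᵢ∧σ′ᵢ]) (m≤sum _ i)
    where
    1≡[σᵢ∧σ′ᵢ] : 1 ≡ [ supp v i ∧ supp w i ]
    1≡[σᵢ∧σ′ᵢ] = cong₂ (λ b b′ → [ b ∧ b′ ]) (sym (nonzero?-≉0 vi≉0)) (sym (nonzero?-≉0 wi≉0))

  -- A code of dimension k is given by a linear map φ : F^k → F^n (a generator matrix); weights
  -- are counted only on the coordinates in S, which shrink along Griesmer's induction.
  WeightsAtLeast : ∀ {k n} → (Fin n → Bool) → ℕ → (Vec F k → Vec F n) → Set (a ⊔ ℓ)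
  WeightsAtLeast S d φ = ∀ a → Nonzero F a → d ≤ weightOn S (φ a)

  insertAt-+•-nonzero : ∀ {k} {a : Vec F k} {a₀ : Vec F (suc k)} j α →
    Nonzero F a → ¬ a₀ j ≈ 0# → Nonzero F (insertAt a j 0# +ᵥ α • a₀)
  insertAt-+•-nonzero {a = a} {a₀} j α a≉0 a₀j≉0 v≈0 =
    a≉0 (λ i → ≈-trans (≈-reflexive (sym (insertAt-punchIn a j 0# i)))
                       (x+y≈0∧y≈0⇒x≈0 (v≈0 (punchIn j i)) (α*y≈0 (a₀ (punchIn j i)))))
    where
    α≈0 : α ≈ 0#
    α≈0 = x*y≈0∧y≉0⇒x≈0 (x+y≈0∧x≈0⇒y≈0 (v≈0 j) (≈-reflexive (insertAt-lookup a j 0#))) a₀j≉0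
    α*y≈0 : ∀ y → α *ᶠ y ≈ 0#
    α*y≈0 y = ≈-trans (*-congʳ α≈0) (zeroˡ y)

  residual-weights : ∀ {k n} (S : Fin n → Bool) {d} {φ : Vec F (suc k) → Vec F n} →
    IsLinear φ → WeightsAtLeast S d φ →
    ∀ {a₀} j → ¬ a₀ j ≈ 0# → weightOn S (φ a₀) ≡ d →
    WeightsAtLeast (S ∖ supp (φ a₀)) ⌈ d / q ⌉ (λ a → φ (insertAt a j 0#))
  residual-weights {n = n} S {d} {φ} φ-lin H {a₀} j a₀j≉0 w≡d a a≉0 =
    ⌈m/n⌉≤o (d≤m*q q*d≤∑ ∑+d≤)
    where
    x c : Vec F n
    x = φ (insertAt a j 0#)
    c = φ a₀
    W : Fin q → ℕ
    W t = weightOn S (x +ᵥ enum t • c)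
    d≤W : ∀ t → d ≤ W t
    d≤W t = subst (d ≤_) (weightOn-cong S (IsLinear.+•-homo φ-lin (insertAt a j 0#) (enum t) a₀))
                  (H _ (insertAt-+•-nonzero j (enum t) a≉0 a₀j≉0))
    q*d≤∑ : q * d ≤ sum W
    q*d≤∑ = subst (_≤ sum W) (sum-const q d) (sum-mono-≤ d≤W)
    ∑+d≤ : sum W + d ≤ q * (weightOn (S ∖ supp c) x + d)
    ∑+d≤ = subst (λ w → sum W + w ≤ q * (weightOn (S ∖ supp c) x + w)) w≡d (averaging S x c)
    d≤m*q : ∀ {m A} → q * d ≤ A → A + d ≤ q * (m + d) → d ≤ m * q
    d≤m*q {m} {A} q*d≤A A+d≤ = subst (d ≤_) (ℕₚ.*-comm q m) (ℕₚ.+-cancelʳ-≤ (q * d) d (q * m) (begin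
      d + q * d      ≡⟨ ℕₚ.+-comm d (q * d) ⟩
      q * d + d      ≤⟨ ℕₚ.+-monoˡ-≤ d q*d≤A ⟩
      A + d          ≤⟨ A+d≤ ⟩
      q * (m + d)    ≡⟨ ℕₚ.*-distribˡ-+ q m d ⟩
      q * m + q * d  ∎))
      where open ℕₚ.≤-Reasoning

  griesmer-step : ∀ {k n} (S : Fin n → Bool) {d} {φ : Vec F (suc k) → Vec F n} →
    IsLinear φ → WeightsAtLeast S d φ →
    (∀ {S′ d′} {φ′ : Vec F k → Vec F n} → IsLinear φ′ → WeightsAtLeast S′ d′ φ′ → griesmer q k d′ ≤ ∣ S′ ∣) →
    ∀ a₀ → Nonzero F a₀ → weightOn S (φ a₀) ≡ d → griesmer q (suc k) d ≤ ∣ S ∣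
  griesmer-step {k} S {d} {φ} φ-lin H griesmer-k a₀ a₀≉0 w≡d = begin
    griesmer q (suc k) d                     ≤⟨ griesmer-suc q k d ⟩
    d + griesmer q k ⌈ d / q ⌉               ≤⟨ ℕₚ.+-monoʳ-≤ d (griesmer-k (∘-isLinear φ-lin (insertAt-isLinear j))
                                                  (residual-weights S φ-lin H j a₀j≉0 w≡d)) ⟩
    d + ∣ S ∖ supp (φ a₀) ∣                  ≡⟨ cong (_+ ∣ S ∖ supp (φ a₀) ∣) w≡d ⟨
    weightOn S (φ a₀) + ∣ S ∖ supp (φ a₀) ∣  ≡⟨ ∣S∩T∣+∣S∖T∣≡∣S∣ S (supp (φ a₀)) ⟩
    ∣ S ∣                                    ∎
    where
    open ℕₚ.≤-Reasoning
    nonzero-coefficient : ∃ λ j → ¬ a₀ j ≈ 0#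
    nonzero-coefficient = ¬∀⟶∃¬ _ (λ i → a₀ i ≈ 0#) (λ i → a₀ i ≟ 0#) a₀≉0
    j : Fin (suc k)
    j = proj₁ nonzero-coefficient
    a₀j≉0 : ¬ a₀ j ≈ 0#
    a₀j≉0 = proj₂ nonzero-coefficient

  -- No codeword of minimal weight is searched for: if the bound fails at d, griesmer-step shows
  -- that no weight equals d, so all weights are at least d + 1; they are at most ∣ S ∣.
  griesmer-bound : ∀ k {n} (S : Fin n → Bool) d {φ : Vec F k → Vec F n} →
    IsLinear φ → WeightsAtLeast S d φ → griesmer q k d ≤ ∣ S ∣
  griesmer-bound zero    S d φ-lin H = z≤n
  griesmer-bound (suc k) S d {φ} φ-lin =
    bounded-upward-induction ∣ S ∣ (λ d → griesmer q (suc k) d ≤? ∣ S ∣)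
      (ℕₚ.≤-trans (griesmer-monoʳ-≤ q (suc k) (ℕₚ.n≤1+n _))) bounded step
    where
    1ᵥ : Vec F (suc k)
    1ᵥ _ = 1#
    bounded : ∀ {d} → WeightsAtLeast S d φ → d ≤ ∣ S ∣
    bounded H = ℕₚ.≤-trans (H 1ᵥ (λ 1ᵥ≈0 → 0≉1 (≈-sym (1ᵥ≈0 Fin.zero)))) (∣S∩T∣≤∣S∣ S _)
    step : ∀ {d} → WeightsAtLeast S d φ → ¬ griesmer q (suc k) d ≤ ∣ S ∣ → WeightsAtLeast S (suc d) φ
    step H ¬bound a a≉0 = ℕₚ.≤∧≢⇒< (H a a≉0)
      (λ d≡w → ¬bound (griesmer-step S φ-lin H (griesmer-bound k _ _) a a≉0 (sym d≡w)))

  intersecting⇒weights≥dim : ∀ {k n} {φ : Vec F k → Vec F n} → IsLinear φ →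
    (∀ a a′ → Nonzero F a → Nonzero F a′ → ∃ λ i → ¬ φ a i ≈ 0# × ¬ φ a′ i ≈ 0#) →
    WeightsAtLeast (λ _ → true) k φ
  intersecting⇒weights≥dim {k} {φ = φ} φ-lin meet a a≉0 =
    subst (_≤ ∣ supp (φ a) ∣) (griesmer-1 q k) (griesmer-bound k (supp (φ a)) 1 φ-lin meets-supp)
    where
    meets-supp : WeightsAtLeast (supp (φ a)) 1 φ
    meets-supp a′ a′≉0 with meet a a′ a≉0 a′≉0
    ... | i , φai≉0 , φa′i≉0 = 1≤weightOn-supp i φai≉0 φa′i≉0

  lincomb∈ : ∀ {k n} {C : Vec F n → Set ℓ} → IsLinearCode F C →
             ∀ a {b : Fin k → Vec F n} → (∀ j → C (b j)) → C (lincomb F a b)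
  lincomb∈ {zero}  lin a b∈C = IsLinearCode.has0 lin
  lincomb∈ {suc k} lin a b∈C = IsLinearCode.+-cl lin _ _ (IsLinearCode.•-cl lin _ _ (b∈C Fin.zero))
                                  (lincomb∈ lin (a ∘ Fin.suc) (b∈C ∘ Fin.suc))

corollary3p2 : ∀ {c ℓ : Level} {q : ℕ} (F : FiniteField c ℓ q) (n k d : ℕ)
    (C : Vec F n → Set ℓ) → IsLinearCode F C → Intersecting F C →
    MinDistance F C d → HasDimension F C k →
    Σ< k (λ j → ⌈ k / q ^ j ⌉) ≤ n
corollary3p2 {q = q} F n k d C lin intersecting _ (b , b∈C , b-independent , _) =
  subst (griesmer q k k ≤_) (∣full∣≡n n)
    (griesmer-bound F k (λ _ → true) k φ-lin (intersecting⇒weights≥dim F φ-lin meet))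
  where
  open FiniteField F using (_≈_; 0#)
  φ-lin : IsLinear F (λ a → lincomb F a b)
  φ-lin = lincomb-isLinear F b
  meet : ∀ a a′ → Nonzero F a → Nonzero F a′ → ∃ λ i → ¬ lincomb F a b i ≈ 0# × ¬ lincomb F a′ b i ≈ 0#
  meet a a′ a≉0 a′≉0 = intersecting _ _ (lincomb∈ F lin a b∈C) (lincomb∈ F lin a′ b∈C)
    (a≉0 ∘ b-independent a) (a′≉0 ∘ b-independent a′)
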